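{- Consider an instance of $\textsc{Solo Chess}(\{S^1,T\})$ with location set $L$. Let $p_0, p_1, \dots, p_k$ be a hero path such that every villain is strongly capturable by $p_0, \dots, p_k$. Then there is a solution in which the hero makes exactly $k$ moves, through the sequence of locations $p_0, p_1, \dots, p_k$.
   Context: Generalized model: a board is a finite set $L$ of locations with pieces at distinct locations; standing assumption: every location is initially occupied. A move is a sequence $\langle \ell_0,\dots,\ell_k\rangle$ of locations ($k\ge1$), valid if $\ell_0,\ell_k$ are occupied and $\ell_1,\dots,\ell_{k-1}$ are empty; executing it removes the piece at $\ell_k$ and moves the piece at $\ell_0$ there. A piece type is a set of moves; it is closed under submoves if $\langle \ell_0,\dots,\ell_k\rangle\in T$ implies $\langle\ell_i,\dots,\ell_j\rangle\in T$ for all $0\le i<j\le k$, and symmetric if closed under reversing sequences. Standing assumptions: $S,T$ are piece types closed under submoves, $S\subseteq T$, and $T$ is symmetric. $\textsc{Solo Chess}(\{S^1,T\})$: the board has exactly one piece of type $S$ (the hero), all other pieces are of type $T$ (villains); a solution is a sequence of valid moves (each in the type of the moving piece) that never captures the hero and leaves only the hero. For disjoint location sets $V,B$, $\operatorname{ICG}(V,B)$ is the directed graph on vertex set $V$ with an edge $(\ell_0,\ell_m)$ whenever $\langle \ell_0,\dots,\ell_m\rangle\in T$ and none of $\ell_1,\dots,\ell_{m-1}$ lies in $V\cup B$. A hero location sequence is a sequence $p_0,\dots,p_k$ of locations with $p_0$ the hero's initial location; it is a hero path if additionally the hero has moves in $S$ from $p_0$ to $p_1$, from $p_1$ to $p_2$,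 ..., from $p_{k-1}$ to $p_k$ that are valid when executed in succession in the initial board with no other moves made. For $0\le i<k$ let $H_i=\operatorname{ICG}(L\setminus\{p_0,\dots,p_i\},\{p_i\})$. A villain at location $v$ is strongly capturable by $p_0,\dots,p_k$ if for some $0\le i<k$ there is a directed walk in $H_i$ from $v$ to $p_{i+1}$. -}

module Defs where

open import Data.Nat using (ℕ; zero; suc; _≤_)
open import Data.Fin using (Fin; toℕ; inject₁; _≟_)
import Data.Fin
open import Data.Bool using (Bool; true; false; if_then_else_)
open import Data.List using (List; []; _∷_; _++_; reverse; length)
open import Data.List.Relation.Unary.All using (All)
open import Data.Product using (Σ; ∃; _×_; _,_)
open import Data.Sum using (_⊎_)
open import Relation.Nullary using (¬_; does)
open import Relation.Binary.PropositionalEquality using (_≡_; _≢_)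
open import Relation.Binary.Construct.Closure.ReflexiveTransitive using (Star)

-- The location set L is  Fin n.  A piece type is a predicate on location
-- sequences (only sequences of length ≥ 2 are ever used as moves).
PieceType : ℕ → Set₁
PieceType n = List (Fin n) → Set

ClosedUnderSubmoves : ∀ {n} → PieceType n → Set
ClosedUnderSubmoves {n} P =
  ∀ (xs ys zs : List (Fin n)) → 2 ≤ length ys → P (xs ++ ys ++ zs) → P ys

Symmetric : ∀ {n} → PieceType n → Set
Symmetric P = ∀ xs → P xs → P (reverse xs)

record Move (n : ℕ) : Set where
  constructor mv
  field
    src : Fin n
    mid : List (Fin n)
    dst : Fin n

open Move public

seq : ∀ {n} → Move n → List (Fin n)
seq m = src m ∷ (mid m ++ dst m ∷ [])

record State (n : ℕ) : Set where
  constructor st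
  field
    occ  : Fin n → Bool
    hero : Fin n

open State public

Valid : ∀ {n} → (Fin n → Bool) → Move n → Set
Valid o m = src m ≢ dst m × o (src m) ≡ true × o (dst m) ≡ true
          × All (λ l → o l ≡ false) (mid m)

after : ∀ {n} → (Fin n → Bool) → Move n → (Fin n → Bool)
after o m l = if does (l ≟ src m) then false else o l

-- execution of a sequence of moves; the index list records the successive
-- destinations of the hero (i.e. the locations it moves to, in order)
data Exec {n} (S T : PieceType n) : State n → List (Fin n) → State n → Set where
  done : ∀ {s} → Exec S T s [] s
  heroStep : ∀ {s t s'} (m : Move n) →
    src m ≡ hero s → Valid (occ s) m → S (seq m) →
    Exec S T (st (after (occ s) m) (dst m)) t s' →
    Exec S T s (dst m ∷ t) s'
  villainStep : ∀ {s t s'} (m : Move n) →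
    src m ≢ hero s → dst m ≢ hero s → Valid (occ s) m → T (seq m) →
    Exec S T (st (after (occ s) m) (hero s)) t s' →
    Exec S T s t s'

data HeroExec {n} (S : PieceType n) : State n → List (Fin n) → State n → Set where
  done : ∀ {s} → HeroExec S s [] s
  heroStep : ∀ {s t s'} (m : Move n) →
    src m ≡ hero s → Valid (occ s) m → S (seq m) →
    HeroExec S (st (after (occ s) m) (dst m)) t s' →
    HeroExec S s (dst m ∷ t) s'

initial : ∀ {n} → Fin n → State n
initial h = st (λ _ → true) h

trace : ∀ {n k} → (Fin (suc k) → Fin n) → List (Fin n)
trace {k = zero}  p = []
trace {k = suc k} p = p (Data.Fin.suc Data.Fin.zero) ∷ trace {k = k} (λ j → p (Data.Fin.suc j))

HeroPath : ∀ {n k} (S : PieceType n) (h : Fin n) → (Fin (suc k) → Fin n) → Set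
HeroPath S h p = p Data.Fin.zero ≡ h × ∃ λ s' → HeroExec S (initial h) (trace p) s'

ICGEdge : ∀ {n} (T : PieceType n) (V B : Fin n → Set) → Fin n → Fin n → Set
ICGEdge {n} T V B a b = V a × V b ×
  Σ (List (Fin n)) λ ms → T (a ∷ (ms ++ b ∷ [])) × All (λ l → ¬ (V l ⊎ B l)) ms

Hvert : ∀ {n k} → (Fin (suc k) → Fin n) → Fin k → Fin n → Set
Hvert {k = k} p i l = ¬ (Σ (Fin (suc k)) λ j → toℕ j ≤ toℕ i × p j ≡ l)

Hbad : ∀ {n k} → (Fin (suc k) → Fin n) → Fin k → Fin n → Set
Hbad p i l = l ≡ p (inject₁ i)

StronglyCapturable : ∀ {n k} (T : PieceType n) → (Fin (suc k) → Fin n) → Fin n → Set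
StronglyCapturable {k = k} T p v =
  Σ (Fin k) λ i → Hvert p i v ×
    Star (ICGEdge T (Hvert p i) (Hbad p i)) v (p (Data.Fin.suc i))

SolutionVia : ∀ {n k} (S T : PieceType n) (h : Fin n) → (Fin (suc k) → Fin n) → Set
SolutionVia {n} S T h p = Σ (State n) λ s' →
  Exec S T (initial h) (trace p) s' × (∀ l → occ s' l ≡ true → l ≡ hero s')

module Submission where

-- Every villain is captured at the last stage i at which it can reach p_{i+1} in H_i.  At stage i
-- (hero on p_i) these villains are removed farthest-first along walks of H_i towards p_{i+1}; every
-- vertex of such a walk can reach p_{i+1} in H_i, so it is either removed in this stage or still
-- present, and the interior of each H_i edge lies among p_0, …, p_{i-1}, which are already vacated.
-- The hero then captures p_{i+1}; its move is valid because the board only ever shrinks compared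
-- with the run in which the hero moves alone.  Reachability in H_i is decided by restricting H_i to
-- the finitely many edges of the given capturing walks and bounding walk lengths by a common fuel.

open import Defs
open import Level using (0ℓ)
open import Data.Nat
  using (ℕ; zero; suc; _+_; _≤_; _<_; _⊓_; _⊔_; _≤′_; ≤′-refl; ≤′-step; s≤s; z≤n; s≤s⁻¹; _≤?_)
open import Data.Nat.Properties
  using ( ≤-refl; ≤-reflexive; ≤-trans; <-irrefl; <-≤-trans; ≤-<-trans; <⇒≤; ≤⇒≤′; n≤1+n; m<m+n
        ; m≤n⇒m<n∨m≡n; +-suc; +-comm; +-identityʳ; m≤m⊔n; m≤n⊔m; m⊓n≤n; m≤n⇒m⊓n≡m; anyUpTo?)
open import Data.Fin using (Fin; zero; suc; toℕ; fromℕ<; inject₁; _≟_)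
open import Data.Fin.Properties
  using (any?; fromℕ<-cong; fromℕ<-toℕ; toℕ-fromℕ<; toℕ-inject₁; toℕ≤pred[n]; toℕ<n)
open import Data.Bool using (Bool; true; false)
open import Data.Bool.Properties using (¬-not)
open import Data.List using (List; []; _∷_; _++_; allFin; concatMap)
open import Data.List.Membership.Propositional using (_∈_)
open import Data.List.Membership.Propositional.Properties using (∈-allFin; ∈-concatMap⁺)
open import Data.List.Relation.Unary.Any as Any using (Any; here; there; tail; satisfied)
open import Data.List.Relation.Unary.All as All using (All; []; _∷_)
open import Data.List.Relation.Unary.AllPairs as AllPairs using (AllPairs)
open import Data.Product using (∃; _×_; _,_; proj₁; proj₂)
open import Data.Sum using (_⊎_; inj₁; inj₂; [_,_])
open import Function using (case_of_)
open import Relation.Nullary using (¬_; Dec; yes; no; ¬?; contradiction)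
open import Relation.Nullary.Decidable using (_×-dec_; _⊎-dec_)
open import Relation.Unary using (Pred; Decidable; _⊆_; _≐_; _∪_; _∩_; ∁; ∅; ｛_｝)
open import Relation.Unary.Properties using (∁?; _∩?_; _∪?_; ≐-trans)
open import Relation.Binary.Core using (Rel)
import Relation.Binary.Definitions as Binary
open import Relation.Binary.PropositionalEquality
  using (_≡_; _≢_; refl; sym; trans; cong; cong₂; subst)
open import Relation.Binary.Construct.Closure.ReflexiveTransitive as Star using (Star; ε; _◅_)

Occupied : ∀ {n} → (Fin n → Bool) → Pred (Fin n) 0ℓ
Occupied o l = o l ≡ true

vacant-⊆ : ∀ {n} {o o' : Fin n → Bool} {l} → Occupied o' ⊆ Occupied o → o l ≡ false → o' l ≡ false
vacant-⊆ o'⊆o ol≡false = ¬-not λ o'l → case trans (sym (o'⊆o o'l)) ol≡false of λ ()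

≐-∩ʳ : ∀ {A : Set} {P Q R : Pred A 0ℓ} → P ≐ Q → P ∩ R ≐ Q ∩ R
≐-∩ʳ (P⊆Q , Q⊆P) = (λ (x∈P , x∈R) → P⊆Q x∈P , x∈R) , λ (x∈Q , x∈R) → Q⊆P x∈Q , x∈R

after-≐ : ∀ {n} (o : Fin n → Bool) (m : Move n) → Occupied (after o m) ≐ Occupied o ∩ ∁ ｛ src m ｝
after-≐ o m = occupied-after , after-occupied
  where
  occupied-after : Occupied (after o m) ⊆ Occupied o ∩ ∁ ｛ src m ｝
  occupied-after {l} occ with l ≟ src m
  ... | no l≢src = occ , λ src≡l → l≢src (sym src≡l)
  occupied-after () | yes _
  after-occupied : Occupied o ∩ ∁ ｛ src m ｝ ⊆ Occupied (after o m)
  after-occupied {l} (occ , src≢l) with l ≟ src m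
  ... | yes l≡src = contradiction (sym l≡src) src≢l
  ... | no _ = occ

after-mono : ∀ {n} {o o' : Fin n → Bool} (m : Move n) →
  Occupied o' ⊆ Occupied o → Occupied (after o' m) ⊆ Occupied (after o m)
after-mono {o = o} {o'} m o'⊆o occ =
  let occ' , src≢l = proj₁ (after-≐ o' m) occ in proj₂ (after-≐ o m) (o'⊆o occ' , src≢l)

Exec-++ : ∀ {n} {S T : PieceType n} {s₀ s₁ s₂ t₁ t₂} →
  Exec S T s₀ t₁ s₁ → Exec S T s₁ t₂ s₂ → Exec S T s₀ (t₁ ++ t₂) s₂
Exec-++ done e = e
Exec-++ (heroStep m src≡hero valid legal e₁) e₂ = heroStep m src≡hero valid legal (Exec-++ e₁ e₂)
Exec-++ (villainStep m src≢hero dst≢hero valid legal e₁) e₂ =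
  villainStep m src≢hero dst≢hero valid legal (Exec-++ e₁ e₂)

Vacates : ∀ {n} (S T : PieceType n) → Fin n → (Fin n → Bool) → Pred (Fin n) 0ℓ → Set
Vacates S T hero o Y =
  ∃ λ o' → Exec S T (st o hero) [] (st o' hero) × Occupied o' ≐ Occupied o ∩ ∁ Y

module _ {n} {S T : PieceType n} {hero : Fin n} where

  vacates-nothing : ∀ {o Y} → Y ⊆ ∅ → Vacates S T hero o Y
  vacates-nothing {o} Y⊆∅ = o , done , (λ occ → occ , Y⊆∅) , proj₁

  vacates-resp : ∀ {o Y Z} → Y ≐ Z → Vacates S T hero o Y → Vacates S T hero o Z
  vacates-resp (Y⊆Z , Z⊆Y) (o' , exec , o'⊆ , ⊆o') =
    o' , exec , (λ occ → let occ' , ∉Y = o'⊆ occ in occ' , λ z → ∉Y (Z⊆Y z))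
              , λ (occ , ∉Z) → ⊆o' (occ , λ y → ∉Z (Y⊆Z y))

  vacates-∪ : ∀ {o Y Z} → Vacates S T hero o Y →
    (∀ {o'} → Occupied o' ≐ Occupied o ∩ ∁ Y → Vacates S T hero o' Z) → Vacates S T hero o (Y ∪ Z)
  vacates-∪ (o₁ , exec₁ , o₁⊆ , ⊆o₁) then with then (o₁⊆ , ⊆o₁)
  ... | o₂ , exec₂ , o₂⊆ , ⊆o₂ =
    o₂ , Exec-++ exec₁ exec₂
       , (λ occ → let occ₁ , ∉Z = o₂⊆ occ ; occ₀ , ∉Y = o₁⊆ occ₁ in occ₀ , [ ∉Y , ∉Z ])
       , λ (occ , ∉Y∪Z) → ⊆o₂ (⊆o₁ (occ , λ y → ∉Y∪Z (inj₁ y)) , λ z → ∉Y∪Z (inj₂ z))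

  vacates-move : ∀ {o} (m : Move n) → src m ≢ hero → dst m ≢ hero → Valid o m → T (seq m) →
    Vacates S T hero o ｛ src m ｝
  vacates-move {o} m src≢hero dst≢hero valid legal =
    after o m , villainStep m src≢hero dst≢hero valid legal done , after-≐ o m

uniform-bound : ∀ {n ℓ} {P : ℕ → Pred (Fin n) ℓ} → (∀ {d d'} → d ≤ d' → P d ⊆ P d') →
  (∀ x → ∃ λ d → P d x) → ∃ λ D → ∀ x → P D x
uniform-bound {zero} mono bound = 0 , λ ()
uniform-bound {suc n} {P = P} mono bound
  with bound zero | uniform-bound {P = λ d x → P d (suc x)} (λ d≤d' → mono d≤d') (λ x → bound (suc x))
... | d , Pd | D , PD = d ⊔ D , λ { zero → mono (m≤m⊔n d D) Pd ; (suc x) → mono (m≤n⊔m d D) (PD x) }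

module BoundedReach {n} {E : Rel (Fin n) 0ℓ} (E? : Binary.Decidable E)
  {K : Pred (Fin n) 0ℓ} (K? : Decidable K) where

  Near : ℕ → Pred (Fin n) 0ℓ
  Near zero = K
  Near (suc d) x = Near d x ⊎ ∃ λ w → E x w × Near d w

  near? : ∀ d → Decidable (Near d)
  near? zero = K?
  near? (suc d) x = near? d x ⊎-dec any? (λ w → E? x w ×-dec near? d w)

  Near-mono : ∀ {d d'} → d ≤ d' → Near d ⊆ Near d'
  Near-mono d≤d' = go (≤⇒≤′ d≤d')
    where
    go : ∀ {d d'} → d ≤′ d' → Near d ⊆ Near d'
    go ≤′-refl near = near
    go (≤′-step d≤′d') near = inj₁ (go d≤′d' near)

  Near-⊆ : ∀ {P : Pred (Fin n) 0ℓ} → K ⊆ P → (∀ {a b} → E a b → P a) → ∀ d → Near d ⊆ P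
  Near-⊆ K⊆P E⊆P zero = K⊆P
  Near-⊆ K⊆P E⊆P (suc d) (inj₁ near) = Near-⊆ K⊆P E⊆P d near
  Near-⊆ K⊆P E⊆P (suc d) (inj₂ (_ , e , _)) = E⊆P e

  star⇒near : ∀ {x w} → Star E x w → K w → ∃ λ d → Near d x
  star⇒near ε Kw = 0 , Kw
  star⇒near (e ◅ walk) Kw = let d , near = star⇒near walk Kw in suc d , inj₂ (_ , e , near)

  near⇒star : ∀ d {x} → Near d x → ∃ λ w → K w × Star (λ a b → E a b × Near d b) x w
  near⇒star zero Kx = _ , Kx , ε
  near⇒star (suc d) (inj₁ near) =
    let w , Kw , walk = near⇒star d near in w , Kw , Star.map (λ (e , nb) → e , inj₁ nb) walk
  near⇒star (suc d) (inj₂ (_ , e , near)) =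
    let w , Kw , walk = near⇒star d near
    in w , Kw , (e , inj₁ near) ◅ Star.map (λ (e' , nb) → e' , inj₁ nb) walk

module Clearing {n} (S T : PieceType n) (hero : Fin n)
  {E : Rel (Fin n) 0ℓ} (E? : Binary.Decidable E)
  (via : ∀ {a b} → E a b → List (Fin n))
  (legal : ∀ {a b} (e : E a b) → T (a ∷ via e ++ b ∷ []))
  (off-hero : ∀ {a b} → E a b → a ≢ hero × b ≢ hero) where

  ViaEmpty : (Fin n → Bool) → Set
  ViaEmpty o = ∀ {a b} (e : E a b) → All (λ l → o l ≡ false) (via e)

  ViaEmpty-⊆ : ∀ {o o'} → Occupied o' ⊆ Occupied o → ViaEmpty o → ViaEmpty o'
  ViaEmpty-⊆ {o} {o'} o'⊆o empty e = All.map (vacant-⊆ {o = o} {o'} o'⊆o) (empty e)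

  CanJump : (Fin n → Bool) → Pred (Fin n) 0ℓ → Set
  CanJump o Z = ∀ {z} → Z z → Occupied o z × ∃ λ w → E z w × ¬ Z w × Occupied o w

  Escapes : Pred (Fin n) 0ℓ → Set
  Escapes Y = ∀ {y} → Y y → ∃ λ w → ¬ Y w × Star E y w

  vacate-round-within : ∀ xs {Z} → Decidable Z → Z ⊆ (_∈ xs) →
    ∀ {o} → ViaEmpty o → CanJump o Z → Vacates S T hero o Z
  vacate-round-within [] _ Z⊆[] _ _ = vacates-nothing λ z → case Z⊆[] z of λ ()
  vacate-round-within (x ∷ xs) {Z} Z? Z⊆ {o} empty jump with Z? x
  ... | no x∉Z = vacate-round-within xs Z? (λ z → tail (λ z≡x → x∉Z (subst Z z≡x z)) (Z⊆ z)) empty jump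
  ... | yes x∈Z with jump x∈Z
  ...   | ox , w , e , w∉Z , ow = vacates-resp split (vacates-∪ (vacates-move (mv x (via e) w)
            (proj₁ (off-hero e)) (proj₂ (off-hero e)) (x≢w , ox , ow , empty e) (legal e)) rest)
    where
    x≢w : x ≢ w
    x≢w x≡w = w∉Z (subst Z x≡w x∈Z)
    rest : ∀ {o'} → Occupied o' ≐ Occupied o ∩ ∁ ｛ x ｝ → Vacates S T hero o' (Z ∩ ∁ ｛ x ｝)
    rest (o'⊆ , ⊆o') =
      vacate-round-within xs (Z? ∩? ∁? (x ≟_)) (λ (z , x≢z) → tail (λ z≡x → x≢z (sym z≡x)) (Z⊆ z))
        (ViaEmpty-⊆ (λ occ → proj₁ (o'⊆ occ)) empty)
        λ (z , x≢z) → let oz , w' , e' , w'∉Z , ow' = jump z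
                      in ⊆o' (oz , x≢z) , w' , e' , (λ (w'∈Z , _) → w'∉Z w'∈Z)
                       , ⊆o' (ow' , λ x≡w' → w'∉Z (subst Z x≡w' x∈Z))
    split : ｛ x ｝ ∪ (Z ∩ ∁ ｛ x ｝) ≐ Z
    split = [ (λ x≡z → subst Z x≡z x∈Z) , proj₁ ] , λ {z} z∈Z → case x ≟ z of λ where
      (yes x≡z) → inj₁ x≡z
      (no x≢z) → inj₂ (z∈Z , x≢z)

  vacate-round : ∀ {Z} → Decidable Z → ∀ {o} → ViaEmpty o → CanJump o Z → Vacates S T hero o Z
  vacate-round Z? = vacate-round-within (allFin n) Z? (λ {z} _ → ∈-allFin z)

  module _ {Y : Pred (Fin n) 0ℓ} (Y? : Decidable Y) where
    open BoundedReach E? (∁? Y?)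

    -- Farthest layer first: each piece at distance exactly d + 1 from ∁ Y jumps onto one at
    -- distance d, which has not moved yet.
    vacate-near : ∀ d {o} → ViaEmpty o → (∀ {y} → Y y → Near d y → Occupied o y) →
      (∀ {a b} → E a b → ¬ Y b → Occupied o b) → Vacates S T hero o (Y ∩ Near d)
    vacate-near zero _ _ _ = vacates-nothing λ (y , y∉Y) → y∉Y y
    vacate-near (suc d) {o} empty occ-Y occ-E =
      vacates-resp layers (vacates-∪ (vacate-round Layer? empty jump) inner)
      where
      Layer : Pred (Fin n) 0ℓ
      Layer = Y ∩ Near (suc d) ∩ ∁ (Near d)
      Layer? : Decidable Layer
      Layer? = Y? ∩? near? (suc d) ∩? ∁? (near? d)
      jump : CanJump o Layer
      jump (_ , inj₁ near , far) = contradiction near far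
      jump (y , inj₂ (w , e , near) , _) =
        occ-Y y (inj₂ (w , e , near)) , w , e , (λ (_ , _ , far) → far near) , occupied (Y? w)
        where
        occupied : Dec (Y w) → Occupied o w
        occupied (yes yw) = occ-Y yw (inj₁ near)
        occupied (no ¬yw) = occ-E e ¬yw
      inner : ∀ {o'} → Occupied o' ≐ Occupied o ∩ ∁ Layer → Vacates S T hero o' (Y ∩ Near d)
      inner (o'⊆ , ⊆o') = vacate-near d (ViaEmpty-⊆ (λ occ → proj₁ (o'⊆ occ)) empty)
        (λ y near → ⊆o' (occ-Y y (inj₁ near) , λ (_ , _ , far) → far near))
        (λ e b∉Y → ⊆o' (occ-E e b∉Y , λ (b∈Y , _) → b∉Y b∈Y))
      layers : Layer ∪ (Y ∩ Near d) ≐ Y ∩ Near (suc d)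
      layers = [ (λ (y , near , _) → y , near) , (λ (y , near) → y , inj₁ near) ]
             , λ {x} (y , near) → case near? d x of λ where
                 (yes near') → inj₂ (y , near')
                 (no far) → inj₁ (y , near , far)

    escapes⇒near : Escapes Y → ∃ λ D → ∀ x → Y x → Near D x
    escapes⇒near escape = uniform-bound (λ d≤d' near y → Near-mono d≤d' (near y)) near-some
      where
      near-some : ∀ x → ∃ λ d → Y x → Near d x
      near-some x with Y? x
      ... | no x∉Y = 0 , λ x∈Y → contradiction x∈Y x∉Y
      ... | yes x∈Y = let w , w∉Y , walk = escape x∈Y ; d , near = star⇒near walk w∉Y in d , λ _ → near

    vacate : ∀ {o} → ViaEmpty o → Y ⊆ Occupied o → (∀ {a b} → E a b → ¬ Y b → Occupied o b) →
      Escapes Y → Vacates S T hero o Y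
    vacate empty occ-Y occ-E escape =
      let D , near = escapes⇒near escape
      in vacates-resp (proj₁ , λ {x} y → y , near x y) (vacate-near D empty (λ y _ → occ-Y y) occ-E)

-- p as a sequence indexed by ℕ; beyond k it stays at p k.
stop : ∀ {k} {A : Set} → (Fin (suc k) → A) → ℕ → A
stop {k} p j = p (fromℕ< (s≤s (m⊓n≤n j k)))

stop-toℕ : ∀ {k} {A : Set} (p : Fin (suc k) → A) (f : Fin (suc k)) → stop p (toℕ f) ≡ p f
stop-toℕ {k} p f =
  cong p (trans (fromℕ<-cong _ _ (m≤n⇒m⊓n≡m (toℕ≤pred[n] f)) _ (toℕ<n f)) (fromℕ<-toℕ f (toℕ<n f)))

stop-fromℕ< : ∀ {k a} {A : Set} (p : Fin (suc k) → A) (a<1+k : a < suc k) → p (fromℕ< a<1+k) ≡ stop p a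
stop-fromℕ< p a<1+k = trans (sym (stop-toℕ p _)) (cong (stop p) (toℕ-fromℕ< a<1+k))

hops : ∀ {A : Set} → (ℕ → A) → ℕ → ℕ → List A
hops f i zero = []
hops f i (suc r) = f (suc i) ∷ hops f (suc i) r

trace-hops : ∀ {n r} (q : Fin (suc r) → Fin n) (f : ℕ → Fin n) i →
  (∀ j → q j ≡ f (i + toℕ j)) → trace q ≡ hops f i r
trace-hops {r = zero} q f i q≗f = refl
trace-hops {r = suc r} q f i q≗f =
  cong₂ _∷_ (trans (q≗f (suc zero)) (cong f (+-comm i 1)))
            (trace-hops (λ j → q (suc j)) f (suc i) (λ j → trans (q≗f (suc j)) (cong f (+-suc i (toℕ j)))))

trace≡hops : ∀ {n k} (p : Fin (suc k) → Fin n) → trace p ≡ hops (stop p) 0 k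
trace≡hops p = trace-hops p (stop p) 0 (λ j → sym (stop-toℕ p j))

∈-hops : ∀ {A : Set} (f : ℕ → A) r {i b} → i < b → b ≤ i + r → f b ∈ hops f i r
∈-hops f zero {i} i<b b≤i+0 =
  contradiction (<-≤-trans i<b (subst (_ ≤_) (+-identityʳ i) b≤i+0)) (<-irrefl refl)
∈-hops f (suc r) {i} {b} i<b b≤ with m≤n⇒m<n∨m≡n i<b
... | inj₂ refl = here refl
... | inj₁ 1+i<b = there (∈-hops f r 1+i<b (subst (b ≤_) (+-suc i r) b≤))

hops-injective : ∀ {A : Set} (f : ℕ → A) r {i} → AllPairs _≢_ (f i ∷ hops f i r) →
  ∀ {a b} → i ≤ a → a < b → b ≤ i + r → f a ≢ f b
hops-injective f zero {i} _ i≤a a<b b≤i+0 =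
  contradiction (<-≤-trans (≤-<-trans i≤a a<b) (subst (_ ≤_) (+-identityʳ i) b≤i+0)) (<-irrefl refl)
hops-injective f (suc r) {i} (fi∉ AllPairs.∷ distinct) {b = b} i≤a a<b b≤ with m≤n⇒m<n∨m≡n i≤a
... | inj₂ refl = All.lookup fi∉ (∈-hops f (suc r) a<b b≤)
... | inj₁ i<a = hops-injective f r distinct i<a a<b (subst (b ≤_) (+-suc i r) b≤)

hero-run-distinct : ∀ {n} {S : PieceType n} {o x t s'} → HeroExec S (st o x) t s' →
  All (Occupied o) t × AllPairs _≢_ (x ∷ t)
hero-run-distinct done = [] , [] AllPairs.∷ AllPairs.[]
hero-run-distinct {o = o} (heroStep m refl (src≢dst , _ , dst-occ , _) _ run) =
  let occ , distinct = hero-run-distinct run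
  in dst-occ ∷ All.map (λ occ' → proj₁ (proj₁ (after-≐ o m) occ')) occ
   , (src≢dst ∷ All.map (λ occ' → proj₂ (proj₁ (after-≐ o m) occ')) occ) AllPairs.∷ distinct

stops-distinct : ∀ {n k} {S : PieceType n} {p : Fin (suc k) → Fin n} {s'} →
  HeroExec S (initial (p zero)) (trace p) s' → ∀ {a b} → a < b → b ≤ k → stop p a ≢ stop p b
stops-distinct {k = k} {p = p} run = hops-injective (stop p) k
  (subst (λ t → AllPairs _≢_ (p zero ∷ t)) (trace≡hops p) (proj₂ (hero-run-distinct run))) z≤n

record Capture {n} (T : PieceType n) : Set where
  constructor capture
  field
    from  : Fin n
    via   : List (Fin n)
    to    : Fin n
    legal : T (from ∷ via ++ to ∷ [])

walkCaptures : ∀ {n} {T : PieceType n} {V B : Fin n → Set} {a b} → Star (ICGEdge T V B) a b → List (Capture T)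
walkCaptures ε = []
walkCaptures {a = a} (_◅_ {j = b} (_ , _ , ms , legal , _) walk) = capture a ms b legal ∷ walkCaptures walk

module Schedule {n k} (S T : PieceType n) (p : Fin (suc k) → Fin n)
  (caps : ∀ v → v ≢ p zero → StronglyCapturable T p v)
  (distinct : ∀ {a b} → a < b → b ≤ k → stop p a ≢ stop p b) where

  open Capture

  Visited : ℕ → Pred (Fin n) 0ℓ
  Visited i l = ∃ λ a → a < suc i × stop p a ≡ l

  Fresh : ℕ → Pred (Fin n) 0ℓ
  Fresh i = ∁ (Visited i)

  fresh? : ∀ i → Decidable (Fresh i)
  fresh? i l = ¬? (anyUpTo? (λ a → stop p a ≟ l) (suc i))

  fresh-unvisited : ∀ {a i x} → a ≤ i → Fresh i x → stop p a ≢ x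
  fresh-unvisited a≤i fresh eq = fresh (_ , s≤s a≤i , eq)

  fresh-anti : ∀ {i j} → i ≤ j → Fresh j ⊆ Fresh i
  fresh-anti i≤j fresh (a , a<1+i , eq) = fresh (a , ≤-trans a<1+i (s≤s i≤j) , eq)

  fresh-next : ∀ {i} → i < k → Fresh i (stop p (suc i))
  fresh-next i<k (_ , a<1+i , eq) = distinct a<1+i i<k eq

  hvert⇒fresh : (f : Fin k) → Hvert p f ⊆ Fresh (toℕ f)
  hvert⇒fresh f hv (a , a<1+f , eq) =
    hv ( fromℕ< a<1+k , subst (_≤ toℕ f) (sym (toℕ-fromℕ< a<1+k)) (s≤s⁻¹ a<1+f)
       , trans (stop-fromℕ< p a<1+k) eq)
    where
    a<1+k : a < suc k
    a<1+k = s≤s (≤-trans (s≤s⁻¹ a<1+f) (<⇒≤ (toℕ<n f)))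

  fresh⇒hvert : (f : Fin k) → Fresh (toℕ f) ⊆ Hvert p f
  fresh⇒hvert f fresh (j , j≤f , eq) = fresh (toℕ j , s≤s j≤f , trans (stop-toℕ p j) eq)

  current⇒hbad : (f : Fin k) → ｛ stop p (toℕ f) ｝ ⊆ Hbad p f
  current⇒hbad f eq = trans (sym eq) (trans (cong (stop p) (sym (toℕ-inject₁ f))) (stop-toℕ p (inject₁ f)))

  InICG : ℕ → Fin n → Fin n → Pred (Capture T) 0ℓ
  InICG j a b c =
    from c ≡ a × to c ≡ b × Fresh j a × Fresh j b × All (∁ (Fresh j ∪ ｛ stop p j ｝)) (via c)

  inICG? : ∀ j a b → Decidable (InICG j a b)
  inICG? j a b c = (from c ≟ a) ×-dec (to c ≟ b) ×-dec fresh? j a ×-dec fresh? j b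
                   ×-dec All.all? (∁? (fresh? j ∪? (stop p j ≟_))) (via c)

  villainCaptures : (v : Fin n) → Dec (v ≡ p zero) → List (Capture T)
  villainCaptures v (yes _) = []
  villainCaptures v (no v≢p₀) = walkCaptures (proj₂ (proj₂ (caps v v≢p₀)))

  captures : List (Capture T)
  captures = concatMap (λ v → villainCaptures v (v ≟ p zero)) (allFin n)

  ∈-captures : ∀ v {c} → c ∈ villainCaptures v (v ≟ p zero) → c ∈ captures
  ∈-captures v c∈ =
    ∈-concatMap⁺ (λ u → villainCaptures u (u ≟ p zero)) (Any.map (λ { refl → c∈ }) (∈-allFin v))

  -- ICGEdge is undecidable (T is an arbitrary predicate); H_j restricted to the edges of the
  -- given capturing walks is decidable, and these walks still lie in it.
  Edge : ℕ → Rel (Fin n) 0ℓ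
  Edge j a b = Any (InICG j a b) captures

  edge? : ∀ j → Binary.Decidable (Edge j)
  edge? j a b = Any.any? (inICG? j a b) captures

  edgeVia : ∀ {j a b} → Edge j a b → List (Fin n)
  edgeVia e = via (proj₁ (satisfied e))

  edge-legal : ∀ {j a b} (e : Edge j a b) → T (a ∷ edgeVia e ++ b ∷ [])
  edge-legal e with satisfied e
  ... | c , refl , refl , _ = legal c

  edge-fresh : ∀ {j a b} → Edge j a b → Fresh j a × Fresh j b
  edge-fresh e = let _ , _ , _ , fresh-a , fresh-b , _ = satisfied e in fresh-a , fresh-b

  edge-interior : ∀ {j a b} (e : Edge j a b) → All (∁ (Fresh j ∪ ｛ stop p j ｝)) (edgeVia e)
  edge-interior e = let _ , _ , _ , _ , _ , interior = satisfied e in interior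

  walk⇒edges : (f : Fin k) {a b : Fin n} (walk : Star (ICGEdge T (Hvert p f) (Hbad p f)) a b) →
    (∀ {c} → c ∈ walkCaptures walk → c ∈ captures) → Star (Edge (toℕ f)) a b
  walk⇒edges f ε _ = ε
  walk⇒edges f ((va , vb , _ , _ , interior) ◅ walk) ⊆captures =
    Any.map (λ { refl → refl , refl , hvert⇒fresh f va , hvert⇒fresh f vb , All.map unseen interior })
            (⊆captures (here refl))
    ◅ walk⇒edges f walk (λ c∈ → ⊆captures (there c∈))
    where
    unseen : ∀ {l} → ¬ (Hvert p f l ⊎ Hbad p f l) → ¬ (Fresh (toℕ f) l ⊎ stop p (toℕ f) ≡ l)
    unseen out = [ (λ fresh → out (inj₁ (fresh⇒hvert f fresh))) , (λ eq → out (inj₂ (current⇒hbad f eq))) ]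

  module H (j : ℕ) = BoundedReach (edge? j) (stop p (suc j) ≟_)

  villain-near : ∀ v (v≟p₀ : Dec (v ≡ p zero)) → (∀ {c} → c ∈ villainCaptures v v≟p₀ → c ∈ captures) →
    ∃ λ d → v ≢ p zero → ∃ λ j → j < k × H.Near j d v
  villain-near v (yes v≡p₀) _ = 0 , λ v≢p₀ → contradiction v≡p₀ v≢p₀
  villain-near v (no v≢p₀) ⊆captures =
    let f , _ , walk = caps v v≢p₀
        d , near = H.star⇒near (toℕ f) (walk⇒edges f walk ⊆captures) (stop-toℕ p (suc f))
    in d , λ _ → toℕ f , toℕ<n f , near

  fuel-for-villains : ∃ λ D → ∀ v → v ≢ p zero → ∃ λ j → j < k × H.Near j D v
  fuel-for-villains = uniform-bound {P = λ d v → v ≢ p zero → ∃ λ j → j < k × H.Near j d v}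
    (λ d≤d' near v≢p₀ → let j , j<k , n = near v≢p₀ in j , j<k , H.Near-mono j d≤d' n)
    (λ v → villain-near v (v ≟ p zero) (∈-captures v))

  fuel : ℕ
  fuel = proj₁ fuel-for-villains

  Reach : ℕ → Pred (Fin n) 0ℓ
  Reach j = H.Near j fuel

  Later : ℕ → Pred (Fin n) 0ℓ
  Later i x = ∃ λ j → j < k × i ≤ j × Reach j x

  later? : ∀ i → Decidable (Later i)
  later? i x = anyUpTo? (λ j → (i ≤? j) ×-dec H.near? j fuel x) k

  reach-fresh : ∀ {j} → j < k → Reach j ⊆ Fresh j
  reach-fresh {j} j<k =
    H.Near-⊆ j (λ next≡x → subst (Fresh j) next≡x (fresh-next j<k)) (λ e → proj₁ (edge-fresh e)) fuel

  later-fresh : ∀ {i} → Later i ⊆ Fresh i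
  later-fresh (_ , j<k , i≤j , reach) = fresh-anti i≤j (reach-fresh j<k reach)

  later-suc : ∀ {i} → Later (suc i) ⊆ Later i
  later-suc (j , j<k , i<j , reach) = j , j<k , <⇒≤ i<j , reach

  later-next : ∀ {i} → i < k → Later i (stop p (suc i))
  later-next {i} i<k = i , i<k , ≤-refl , H.Near-mono i z≤n refl

  later-villain : ∀ {v} → v ≢ p zero → Later 0 v
  later-villain {v} v≢p₀ = let j , j<k , near = proj₂ fuel-for-villains v v≢p₀ in j , j<k , z≤n , near

  later-end : ∀ {i x} → k ≤ i → ¬ Later i x
  later-end k≤i (_ , j<k , i≤j , _) = <-irrefl refl (<-≤-trans j<k (≤-trans k≤i i≤j))

  -- the occupied locations while the hero stands on p_i
  Board : ℕ → Pred (Fin n) 0ℓ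
  Board i = ｛ stop p i ｝ ∪ Later i

  -- villains are captured at the last stage at which they can be
  CapturedAt : ℕ → Pred (Fin n) 0ℓ
  CapturedAt i = Later i ∩ ∁ (Later (suc i)) ∩ ∁ ｛ stop p (suc i) ｝

  captured-reach : ∀ {i} → CapturedAt i ⊆ Reach i
  captured-reach {i} ((j , j<k , i≤j , reach) , not-later , _) with m≤n⇒m<n∨m≡n i≤j
  ... | inj₁ i<j = contradiction (j , j<k , i<j , reach) not-later
  ... | inj₂ refl = reach

  vacate-stage : ∀ {i o} → i < k → Occupied o ≐ Board i → Vacates S T (stop p i) o (CapturedAt i)
  vacate-stage {i} {o} i<k (o⊆ , ⊆o) =
    vacate (later? i ∩? ∁? (later? (suc i)) ∩? ∁? (stop p (suc i) ≟_))
      via-empty (λ (later , _) → ⊆o (inj₂ later)) (λ (_ , later) _ → ⊆o (inj₂ later)) escape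
    where
    off-hero : ∀ {a b} → Edge i a b × Later i b → a ≢ stop p i × b ≢ stop p i
    off-hero (e , _) = let fresh-a , fresh-b = edge-fresh e
                       in (λ eq → fresh-unvisited ≤-refl fresh-a (sym eq))
                        , (λ eq → fresh-unvisited ≤-refl fresh-b (sym eq))
    open Clearing S T (stop p i) (λ a b → edge? i a b ×-dec later? i b)
                  (λ (e , _) → edgeVia e) (λ (e , _) → edge-legal e) off-hero
    via-empty : ViaEmpty o
    via-empty (e , _) =
      All.map (λ out → ¬-not λ occ → out ([ inj₂ , (λ later → inj₁ (later-fresh later)) ] (o⊆ occ)))
              (edge-interior e)
    escape : Escapes (CapturedAt i)
    escape captured =
      let w , next≡w , walk = H.near⇒star i fuel (captured-reach captured)
      in w , (λ (_ , _ , ≢next) → ≢next next≡w) , Star.map (λ (e , near) → e , (i , i<k , ≤-refl , near)) walk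

  next-board : ∀ {i} → i < k → (Board i ∩ ∁ (CapturedAt i)) ∩ ∁ ｛ stop p i ｝ ≐ Board (suc i)
  next-board {i} i<k = shrink , grow
    where
    shrink : (Board i ∩ ∁ (CapturedAt i)) ∩ ∁ ｛ stop p i ｝ ⊆ Board (suc i)
    shrink ((inj₁ at-hero , _) , moved) = contradiction at-hero moved
    shrink {x} ((inj₂ later , kept) , _) with later? (suc i) x | stop p (suc i) ≟ x
    ... | yes later' | _ = inj₂ later'
    ... | no _ | yes next≡x = inj₁ next≡x
    ... | no not-later | no not-next = contradiction (later , not-later , not-next) kept
    grow : Board (suc i) ⊆ (Board i ∩ ∁ (CapturedAt i)) ∩ ∁ ｛ stop p i ｝
    grow (inj₁ refl) = (inj₂ (later-next i<k) , λ (_ , _ , not-next) → not-next refl)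
                     , fresh-unvisited ≤-refl (later-fresh (later-next i<k))
    grow (inj₂ later) = (inj₂ (later-suc later) , λ (_ , not-later , _) → not-later later)
                      , fresh-unvisited (n≤1+n i) (later-fresh later)

  stage-< : ∀ {i r} → i + suc r ≡ k → i < k
  stage-< {i} i+r≡k = subst (i <_) i+r≡k (m<m+n i (s≤s z≤n))

  -- o ⊆ oh, the board of the run in which only the hero moves, keeps the hero's moves valid.
  stages : ∀ r i → i + r ≡ k → ∀ {oh s'} → HeroExec S (st oh (stop p i)) (hops (stop p) i r) s' →
    ∀ {o} → Occupied o ⊆ Occupied oh → Occupied o ≐ Board i →
    ∃ λ s'' → Exec S T (st o (stop p i)) (hops (stop p) i r) s'' × (∀ l → occ s'' l ≡ true → l ≡ hero s'')
  stages zero i i+0≡k done _ (o⊆ , _) =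
    _ , done , λ l occ → [ sym , (λ later → contradiction later (later-end k≤i)) ] (o⊆ occ)
    where
    k≤i : k ≤ i
    k≤i = ≤-reflexive (trans (sym i+0≡k) (+-identityʳ i))
  stages (suc r) i i+r≡k {oh} (heroStep m refl (src≢dst , _ , _ , via-empty) legal run) {o} o⊆oh o≐
    with vacate-stage (stage-< i+r≡k) o≐
  ... | o₁ , vacating , o₁≐ =
    let s'' , exec , only-hero =
          stages r (suc i) (trans (sym (+-suc i r)) i+r≡k) run (after-mono {o = oh} {o₁} m o₁⊆oh) board
    in s'' , Exec-++ vacating (heroStep m refl valid legal exec) , only-hero
    where
    i<k : i < k
    i<k = stage-< i+r≡k
    o₁⊆oh : Occupied o₁ ⊆ Occupied oh
    o₁⊆oh occ = o⊆oh (proj₁ (proj₁ o₁≐ occ))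
    valid : Valid o₁ m
    valid = src≢dst
          , proj₂ o₁≐ (proj₂ o≐ (inj₁ refl) , λ captured → fresh-unvisited ≤-refl (later-fresh (proj₁ captured)) refl)
          , proj₂ o₁≐ (proj₂ o≐ (inj₂ (later-next i<k)) , λ (_ , _ , not-next) → not-next refl)
          , All.map (vacant-⊆ {o = oh} {o₁} o₁⊆oh) via-empty
    board : Occupied (after o₁ m) ≐ Board (suc i)
    board = ≐-trans (after-≐ o₁ m) (≐-trans (≐-∩ʳ (≐-trans o₁≐ (≐-∩ʳ o≐))) (next-board i<k))

  initial-board : Occupied (λ _ → true) ≐ Board 0
  initial-board = (λ {x} _ → case p zero ≟ x of λ where
                     (yes p₀≡x) → inj₁ p₀≡x
                     (no p₀≢x) → inj₂ (later-villain (λ x≡p₀ → p₀≢x (sym x≡p₀))))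
                , λ _ → refl

  solution : ∀ {s'} → HeroExec S (initial (p zero)) (trace p) s' → SolutionVia S T (p zero) p
  solution run =
    let run' = subst (λ t → HeroExec S (initial (p zero)) t _) (trace≡hops p) run
        s'' , exec , only-hero = stages k 0 refl run' (λ occ → occ) initial-board
    in s'' , subst (λ t → Exec S T (initial (p zero)) t s'') (sym (trace≡hops p)) exec , only-hero

lemma8 : ∀ {n k} (S T : PieceType n) →
    ClosedUnderSubmoves S → ClosedUnderSubmoves T →
    (∀ xs → S xs → T xs) → Symmetric T →
    (h : Fin n) (p : Fin (suc k) → Fin n) →
    HeroPath S h p →
    (∀ v → v ≢ h → StronglyCapturable T p v) →
    SolutionVia S T h p
lemma8 S T _ _ _ _ h p (refl , _ , run) caps = Schedule.solution S T p caps (stops-distinct run) run
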